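{- (Soundness of LP-Unif.) Let $\Phi$ be a logic program and $A$ an atomic formula. If $\Phi\vdash\{A\}\leadsto^*_\gamma\emptyset$, then there exists a proof term $e$ with $e:\forall\underline{x}.\ \Rightarrow\gamma A$ derivable given axioms $\Phi$.
   Context: First-order terms $t ::= x \mid f(t_1,\dots,t_n)$; atomic formulas $A ::= P(t_1,\dots,t_n)$; Horn formulas $F ::= [\forall \underline{x}].\ A_1,\dots,A_n \Rightarrow A$ ($n\ge0$; for $n=0$ written $\Rightarrow A$), where $\forall\underline{x}.F$ quantifies all free term variables of $F$. Proof terms $p,e ::= \kappa \mid a \mid \lambda a.e \mid e\ e'$ ($\kappa$ proof-term constants, $a$ proof-term variables). A logic program $\Phi$ is a list $\kappa_1 : F_1,\dots,\kappa_k:F_k$ of closed Horn formulas $\forall\underline{x}. B_1,\dots,B_m\Rightarrow C$ labelled by distinct constants. Typing $e:F$ given $\Phi$ is generated by: (axiom) $\kappa:\forall\underline{x}.F$ if $(\kappa:\forall\underline{x}.F)\in\Phi$; (gen) from $e:F$ infer $e:\forall\underline{x}.F$; (inst) from $e:\forall\underline{x}.F$ infer $e:[\underline{t}/\underline{x}]F$; (cut) from $e_1:\underline{A}\Rightarrow D$ and $e_2:\underline{B},D\Rightarrow C$ infer $\lambda\underline{a}.\lambda\underline{b}.(e_2\ \underline{b})\ (e_1\ \underline{a}) : \underline{A},\underline{B}\Rightarrow C$ with $\underline{a},\underline{b}$ fresh proof-term variable lists of the lengths of $\underline{A},\underline{B}$. $A\sim_\gamma A'$ means $\gamma$ is a most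 general (idempotent) unifier: $\gamma A\equiv\gamma A'$. LP-Unif reduction: $\Phi\vdash\{A_1,\dots,A_i,\dots,A_n\}\leadsto_{\kappa,\gamma\cdot\gamma'}\{\gamma A_1,\dots,\gamma B_1,\dots,\gamma B_m,\dots,\gamma A_n\}$ (for current state $\gamma'$) whenever $\kappa:\forall\underline{x}.B_1,\dots,B_m\Rightarrow C\in\Phi$ (variables renamed apart) and $C\sim_\gamma A_i$. $\leadsto^*_\gamma$ denotes a finite reduction sequence, started with the empty substitution as state, whose final accumulated state is $\gamma$. $\forall\underline{x}.\ \Rightarrow\gamma A$ is the universal closure of $\Rightarrow\gamma A$. -}

module Defs where

open import Data.Nat using (ℕ)
open import Data.List using (List; []; _∷_; _++_; foldr; foldl; map; length; concatMap)
open import Data.List.Membership.Propositional using (_∈_; _∉_)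
open import Data.List.Relation.Unary.Unique.Propositional using (Unique)
open import Data.Product using (_×_; _,_; ∃)
open import Relation.Binary.PropositionalEquality using (_≡_)

-- First-order terms over function symbols (ℕ) and term variables (ℕ).
-- Arities are not fixed by a signature: f(t₁,…,tₙ) is  fn f [t₁,…,tₙ].

data Term : Set where
  var : ℕ → Term
  fn  : ℕ → List Term → Term

data Atom : Set where
  atom : ℕ → List Term → Atom

Subst : Set
Subst = ℕ → Term

mutual
  substT : Subst → Term → Term
  substT σ (var x)    = σ x
  substT σ (fn f ts)  = fn f (substTs σ ts)

  substTs : Subst → List Term → List Term
  substTs σ []       = []
  substTs σ (t ∷ ts) = substT σ t ∷ substTs σ ts

substA : Subst → Atom → Atom
substA σ (atom P ts) = atom P (substTs σ ts)

substAs : Subst → List Atom → List Atom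
substAs σ = map (substA σ)

-- composition  γ · γ'  (first γ', then γ)
_·_ : Subst → Subst → Subst
(γ · γ') x = substT γ (γ' x)

mutual
  varsT : Term → List ℕ
  varsT (var x)   = x ∷ []
  varsT (fn f ts) = varsTs ts

  varsTs : List Term → List ℕ
  varsTs []       = []
  varsTs (t ∷ ts) = varsT t ++ varsTs ts

varsA : Atom → List ℕ
varsA (atom P ts) = varsTs ts

varsAs : List Atom → List ℕ
varsAs = concatMap varsA

_≗_ : Subst → Subst → Set
σ ≗ τ = ∀ x → σ x ≡ τ x

IsUnifier : Subst → Atom → Atom → Set
IsUnifier γ A A' = substA γ A ≡ substA γ A'

MGU : Atom → Atom → Subst → Set
MGU A A' γ =
  IsUnifier γ A A' ×
  (∀ σ → IsUnifier σ A A' → ∃ λ δ → σ ≗ (δ · γ)) ×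
  ((γ · γ) ≗ γ)

-- Since the quantifier always binds *all* free term
-- variables, a formula is either an unquantified clause  A₁,…,Aₙ ⇒ A
-- or the universal closure  ∀x̲. A₁,…,Aₙ ⇒ A  of such a clause.

data Formula : Set where
  _⇒_    : List Atom → Atom → Formula
  ∀[_⇒_] : List Atom → Atom → Formula

infix 4 _⇒_

data PTerm : Set where
  con : ℕ → PTerm
  pv  : ℕ → PTerm
  lam : ℕ → PTerm → PTerm
  app : PTerm → PTerm → PTerm

lams : List ℕ → PTerm → PTerm
lams as e = foldr lam e as

apps : PTerm → List ℕ → PTerm
apps e as = foldl (λ f a → app f (pv a)) e as

pvars : PTerm → List ℕ
pvars (con k)   = []
pvars (pv a)    = a ∷ []
pvars (lam a e) = a ∷ pvars e
pvars (app e f) = pvars e ++ pvars f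

-- Logic programs: lists of labelled closed Horn formulas
--   κ : ∀x̲. B₁,…,Bₘ ⇒ C     represented as (κ , [B₁,…,Bₘ] , C).

Clause : Set
Clause = ℕ × List Atom × Atom

Program : Set
Program = List Clause

IsLogicProgram : Program → Set
IsLogicProgram Φ = Unique (map (λ { (κ , _ , _) → κ }) Φ)

infix 3 _⊢_∶_

data _⊢_∶_ (Φ : Program) : PTerm → Formula → Set where
  axiom : ∀ {κ Bs C} → (κ , Bs , C) ∈ Φ → Φ ⊢ con κ ∶ ∀[ Bs ⇒ C ]
  gen   : ∀ {e As A} → Φ ⊢ e ∶ (As ⇒ A) → Φ ⊢ e ∶ ∀[ As ⇒ A ]
  inst  : ∀ {e As A} (σ : Subst) → Φ ⊢ e ∶ ∀[ As ⇒ A ] →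
          Φ ⊢ e ∶ (substAs σ As ⇒ substA σ A)
  cut   : ∀ {e₁ e₂ As Bs D C} (as bs : List ℕ) →
          length as ≡ length As → length bs ≡ length Bs →
          Unique (as ++ bs) →
          (∀ a → a ∈ as ++ bs → a ∉ pvars e₁ ++ pvars e₂) →
          Φ ⊢ e₁ ∶ (As ⇒ D) → Φ ⊢ e₂ ∶ (Bs ++ D ∷ [] ⇒ C) →
          Φ ⊢ lams as (lams bs (app (apps e₂ bs) (apps e₁ as))) ∶ (As ++ Bs ⇒ C)

-- LP-Unif reduction on states (goal list , accumulated substitution).

Injective : (ℕ → ℕ) → Set
Injective ρ = ∀ x y → ρ x ≡ ρ y → x ≡ y

ren : (ℕ → ℕ) → Subst
ren ρ x = var (ρ x)

data _⊢_,_↝_,_ (Φ : Program) : List Atom → Subst → List Atom → Subst → Set where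
  step : ∀ {κ Bs C pre Ai post γ γ'} →
         (κ , Bs , C) ∈ Φ →
         (ρ : ℕ → ℕ) → Injective ρ →
         (∀ x → x ∈ varsAs (substAs (ren ρ) Bs) ++ varsA (substA (ren ρ) C) →
                x ∉ varsAs (pre ++ Ai ∷ post)) →
         MGU (substA (ren ρ) C) Ai γ →
         Φ ⊢ (pre ++ Ai ∷ post) , γ' ↝
             (substAs γ pre ++ substAs γ (substAs (ren ρ) Bs) ++ substAs γ post) , (γ · γ')

data _⊢_,_↝*_,_ (Φ : Program) : List Atom → Subst → List Atom → Subst → Set where
  done : ∀ {G γ} → Φ ⊢ G , γ ↝* G , γ
  more : ∀ {G γ G' γ' G'' γ''} →
         Φ ⊢ G , γ ↝ G' , γ' → Φ ⊢ G' , γ' ↝* G'' , γ'' → Φ ⊢ G , γ ↝* G'' , γ''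

_⊢_↝*∅_ : Program → Atom → Subst → Set
Φ ⊢ A ↝*∅ γ = Φ ⊢ (A ∷ []) , var ↝* [] , γ

-- Each LP-Unif step resolves a goal Aᵢ against a clause κ : ∀x̲. B̲ ⇒ C with
-- an mgu γ of C and Aᵢ.  Reading a successful derivation backwards, one
-- maintains a substitution δ such that the final answer is δ after the
-- current state and every δ-instance of a pending goal has a closed proof.
-- At a step, the δ-instance of γAᵢ equals an instance of C; instantiating
-- κ to it and cutting away the (already proved) instances of B̲ one at a
-- time proves it.  At the start the state is the identity, so δ = γ on A.
module Submission where

open import Defs
open import Data.List using (List; []; _∷_; _++_; length; applyUpTo)
open import Data.List.Extrema.Nat using (max; xs≤max)
open import Data.List.Membership.Propositional using (_∈_; _∉_)
open import Data.List.Membership.Propositional.Properties using (∈-applyUpTo⁻)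
open import Data.List.Properties using (length-applyUpTo)
open import Data.List.Relation.Unary.All as All using (All; []; _∷_)
open import Data.List.Relation.Unary.All.Properties using (map⁺; map⁻; ++⁺; ++⁻)
open import Data.List.Relation.Unary.Unique.Propositional using (Unique)
open import Data.List.Relation.Unary.Unique.Propositional.Properties using (applyUpTo⁺₁)
open import Data.List.Reverse using (Reverse; []; _∶_∶ʳ_; reverseView)
open import Data.Nat using (ℕ; suc; _+_)
open import Data.Nat.Properties using (<⇒≢; <-irrefl; ≤-trans; m≤m+n; +-monoʳ-<)
open import Data.Product using (_×_; _,_; proj₂; ∃)
open import Function using (_∘_)
open import Relation.Binary.PropositionalEquality
  using (_≡_; refl; sym; trans; cong; cong₂; subst; module ≡-Reasoning)

mutual
  substT-id : ∀ t → substT var t ≡ t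
  substT-id (var x)   = refl
  substT-id (fn f ts) = cong (fn f) (substTs-id ts)

  substTs-id : ∀ ts → substTs var ts ≡ ts
  substTs-id []       = refl
  substTs-id (t ∷ ts) = cong₂ _∷_ (substT-id t) (substTs-id ts)

mutual
  substT-· : ∀ σ τ t → substT (σ · τ) t ≡ substT σ (substT τ t)
  substT-· σ τ (var x)   = refl
  substT-· σ τ (fn f ts) = cong (fn f) (substTs-· σ τ ts)

  substTs-· : ∀ σ τ ts → substTs (σ · τ) ts ≡ substTs σ (substTs τ ts)
  substTs-· σ τ []       = refl
  substTs-· σ τ (t ∷ ts) = cong₂ _∷_ (substT-· σ τ t) (substTs-· σ τ ts)

mutual
  substT-cong : ∀ {σ τ} → σ ≗ τ → ∀ t → substT σ t ≡ substT τ t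
  substT-cong σ≗τ (var x)   = σ≗τ x
  substT-cong σ≗τ (fn f ts) = cong (fn f) (substTs-cong σ≗τ ts)

  substTs-cong : ∀ {σ τ} → σ ≗ τ → ∀ ts → substTs σ ts ≡ substTs τ ts
  substTs-cong σ≗τ []       = refl
  substTs-cong σ≗τ (t ∷ ts) = cong₂ _∷_ (substT-cong σ≗τ t) (substTs-cong σ≗τ ts)

substA-· : ∀ σ τ A → substA (σ · τ) A ≡ substA σ (substA τ A)
substA-· σ τ (atom P ts) = cong (atom P) (substTs-· σ τ ts)

substA-cong : ∀ {σ τ} → σ ≗ τ → ∀ A → substA σ A ≡ substA τ A
substA-cong σ≗τ (atom P ts) = cong (atom P) (substTs-cong σ≗τ ts)

All-substAs⁻ : ∀ (P : Atom → Set) σ τ As →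
               All (P ∘ substA σ) (substAs τ As) → All (P ∘ substA (σ · τ)) As
All-substAs⁻ P σ τ As ps = All.map (λ {A} → subst P (sym (substA-· σ τ A))) (map⁻ ps)

fresh-names : ∀ (used : List ℕ) n →
              ∃ λ as → length as ≡ n × Unique as × (∀ a → a ∈ as → a ∉ used)
fresh-names used n =
  applyUpTo (N +_) n , length-applyUpTo (N +_) n ,
  applyUpTo⁺₁ (N +_) n (λ i<j _ → <⇒≢ (+-monoʳ-< N i<j)) , avoids
  where
    N = suc (max 0 used)

    avoids : ∀ a → a ∈ applyUpTo (N +_) n → a ∉ used
    avoids a a∈ a∈used with i , _ , refl ← ∈-applyUpTo⁻ (N +_) a∈ =
      <-irrefl refl (≤-trans (m≤m+n N i) (All.lookup (xs≤max 0 used) a∈used))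

Provable : Program → Atom → Set
Provable Φ A = ∃ λ e → Φ ⊢ e ∶ ([] ⇒ A)

module _ {Φ : Program} where

  cut-provable : ∀ {e₁ e₂ Bs D C} → Φ ⊢ e₁ ∶ ([] ⇒ D) → Φ ⊢ e₂ ∶ (Bs ++ D ∷ [] ⇒ C) →
                 ∃ λ e → Φ ⊢ e ∶ (Bs ⇒ C)
  cut-provable {e₁} {e₂} {Bs} d₁ d₂
    with bs , |bs| , bs-unique , bs-fresh ← fresh-names (pvars e₁ ++ pvars e₂) (length Bs) =
    _ , cut [] bs refl |bs| bs-unique bs-fresh d₁ d₂

  discharge : ∀ {Hs e C} → Reverse Hs → Φ ⊢ e ∶ (Hs ⇒ C) → All (Provable Φ) Hs → Provable Φ C
  discharge []              d _  = _ , d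
  discharge (Hs ∶ r ∶ʳ H) d ps with pHs , (_ , dH) ∷ [] ← ++⁻ Hs ps =
    discharge r (proj₂ (cut-provable dH d)) pHs

  instance-provable : ∀ {κ Bs C} → (κ , Bs , C) ∈ Φ → (σ : Subst) →
                      All (Provable Φ ∘ substA σ) Bs → Provable Φ (substA σ C)
  instance-provable {Bs = Bs} κ∈Φ σ pBs =
    discharge (reverseView (substAs σ Bs)) (inst σ (axiom κ∈Φ)) (map⁺ pBs)

  -- δ is what the rest of the derivation still applies to the state γ₀.
  Justified : List Atom → Subst → Subst → Set
  Justified G γ₀ γ = ∃ λ δ → γ ≗ (δ · γ₀) × All (Provable Φ ∘ substA δ) G

  ↝-justified : ∀ {G γ₀ G' γ₁ γ} → Φ ⊢ G , γ₀ ↝ G' , γ₁ →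
                Justified G' γ₁ γ → Justified G γ₀ γ
  ↝-justified {γ₀ = γ₀} (step {Bs = Bs} {C} {pre} {Ai} {post} {g} κ∈Φ ρ _ _ (unifies , _))
              (δ , γ≗ , pG')
    with pPre , pRest ← ++⁻ (substAs g pre) pG'
    with pBs , pPost  ← ++⁻ (substAs g (substAs (ren ρ) Bs)) pRest =
    δ · g ,
    (λ x → trans (γ≗ x) (sym (substT-· δ g (γ₀ x)))) ,
    ++⁺ (All-substAs⁻ (Provable Φ) δ g pre pPre)
        (pAi ∷ All-substAs⁻ (Provable Φ) δ g post pPost)
    where
      σ = (δ · g) · ren ρ

      σC≡δgAi : substA σ C ≡ substA (δ · g) Ai
      σC≡δgAi = begin
        substA σ C                             ≡⟨ substA-· (δ · g) (ren ρ) C ⟩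
        substA (δ · g) (substA (ren ρ) C)      ≡⟨ substA-· δ g _ ⟩
        substA δ (substA g (substA (ren ρ) C)) ≡⟨ cong (substA δ) unifies ⟩
        substA δ (substA g Ai)                 ≡⟨ sym (substA-· δ g Ai) ⟩
        substA (δ · g) Ai                      ∎
        where open ≡-Reasoning

      pAi : Provable Φ (substA (δ · g) Ai)
      pAi = subst (Provable Φ) σC≡δgAi
        (instance-provable κ∈Φ σ
          (All-substAs⁻ (Provable Φ) (δ · g) (ren ρ) Bs
            (All-substAs⁻ (Provable Φ) δ g (substAs (ren ρ) Bs) pBs)))

  ↝*-justified : ∀ {G γ₀ γ} → Φ ⊢ G , γ₀ ↝* [] , γ → Justified G γ₀ γ
  ↝*-justified {γ = γ} done = var , (λ x → sym (substT-id (γ x))) , []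
  ↝*-justified (more s rest) = ↝-justified s (↝*-justified rest)

theorem1 : (Φ : Program) → IsLogicProgram Φ → (A : Atom) (γ : Subst) →
           Φ ⊢ A ↝*∅ γ →
           ∃ λ (e : PTerm) → Φ ⊢ e ∶ ∀[ [] ⇒ substA γ A ]
theorem1 Φ _ A γ A↝*∅ with δ , γ≗δ , (e , d) ∷ [] ← ↝*-justified A↝*∅ =
  e , gen (subst (λ B → Φ ⊢ e ∶ ([] ⇒ B)) (sym (substA-cong γ≗δ A)) d)
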